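{- Let $\Gamma$ be a finite, connected, simple, undirected graph with at least one edge, $G$ a group, and $s_1,s_2\in Z(G)$ with $s_1^2=s_2^2=1_G$. For $H\in\mathcal H_\Gamma$ the following are equivalent: (1) $H\sim_{l\times r}N_\Gamma(G)$; (2) $\Psi(H)$ is switching equivalent to the constant gain function $\mathbf{s_1}$ on $\Gamma$; (3) $\Psi_L(H)$ is switching equivalent to the constant gain function $\mathbf{s_2}$ on $L(\Gamma)$. In particular, if $s_1=s_2=1_G$, then for any compatible pair $(\psi,\zeta)\in G(\Gamma)\times G(L(\Gamma))$, $(\Gamma,\psi)$ is balanced if and only if $(L(\Gamma),\zeta)$ is balanced.
   Context: Fix orders $V_\Gamma=\{v_1,\dots,v_n\}$, $E_\Gamma=\{e_1,\dots,e_m\}$; write $v_i\in e_j$ if $v_i$ is an endpoint of $e_j$, and $e_i\cap e_j$ for the common endpoint of distinct edges sharing a vertex. $\mathbb CG$ is the complex group algebra with involution $(\sum f_xx)^*=\sum\overline{f_x}x^{ -1}$, $(A^*)_{i,j}=(A_{j,i})^*$. A $G$-phase is $H\in M_{n\times m}(\mathbb CG)$ with $H_{i,j}\in G$ if $v_i\in e_j$ and $H_{i,j}=0$ otherwise; $\mathcal H_\Gamma$ is their set. $N_\Gamma(G)\in\mathcal H_\Gamma$ has entry $1_G$ if $v_i\in e_j$ and $0$ otherwise. For $g\in G^k$, $\underline g=\mathrm{diag}(g_1,\dots,g_k)$; $H_1\sim_{l\times r}H_2$ means $H_1=\underline f^{\,*}H_2\underline g$ for some $f\in G^n,g\in G^m$.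 A $G$-gain function on a graph is a map $\psi$ on ordered pairs of adjacent vertices into $G$ with $\psi(v,u)=\psi(u,v)^{ -1}$; $G(\Gamma)$ denotes those on $\Gamma$; for a weak involution $s$, $\mathbf s$ is the constant gain function with value $s$. Gain functions $\psi_1,\psi_2$ are switching equivalent if there is $f$ from vertices to $G$ with $\psi_2(u,v)=f(u)^{ -1}\psi_1(u,v)f(v)$. A gain graph $(\Gamma,\psi)$ is balanced if the product $\psi(w_1,w_2)\psi(w_2,w_3)\cdots\psi(w_{k-1},w_k)$ equals $1_G$ for every closed walk $w_1,\dots,w_k=w_1$. The line graph $L(\Gamma)$ has vertex set $E_\Gamma$, $e_i\sim e_j$ iff they share an endpoint. $\Psi(H)(v_i,v_j)=s_1H_{i,k}H_{j,k}^{ -1}$ for $e_k=\{v_i,v_j\}$; $\Psi_L(H)(e_i,e_j)=s_2H_{k,i}^{ -1}H_{k,j}$ for $v_k=e_i\cap e_j$. A pair $(\psi,\zeta)\in G(\Gamma)\times G(L(\Gamma))$ is compatible if there is $H\in\mathcal H_\Gamma$ with $\Psi(H)=\psi$ and $\Psi_L(H)=\zeta$. -}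

module Defs where

open import Level using (Level)
open import Data.Nat using (ℕ)
open import Data.Fin using (Fin; _≟_)
open import Data.Fin.Properties using (any?)
open import Data.Product using (Σ; ∃; _×_; _,_; proj₁; proj₂)
open import Data.Sum using (_⊎_)
open import Relation.Binary.PropositionalEquality using (_≡_; _≢_)
open import Relation.Nullary using (Dec; yes; no)
open import Relation.Nullary.Decidable using (_×-dec_; _⊎-dec_)
open import Algebra.Bundles using (Group)

-- Finite simple undirected graphs with ordered vertices v_0..v_{n-1}
-- and ordered edges e_0..e_{m-1}; edge k has endpoints src k, tgt k.

record SimpleGraph : Set where
  field
    n m : ℕ
    src tgt : Fin m → Fin n

  Joins : Fin m → Fin n → Fin n → Set
  Joins k u v = (src k ≡ u × tgt k ≡ v) ⊎ (src k ≡ v × tgt k ≡ u)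

  field
    loopless : ∀ k → src k ≢ tgt k
    noMulti  : ∀ k l → Joins k (src l) (tgt l) → k ≡ l

  joins? : ∀ k u v → Dec (Joins k u v)
  joins? k u v = ((src k ≟ u) ×-dec (tgt k ≟ v)) ⊎-dec ((src k ≟ v) ×-dec (tgt k ≟ u))

  _∈ₑ_ : Fin n → Fin m → Set
  i ∈ₑ j = (i ≡ src j) ⊎ (i ≡ tgt j)

  ∈ₑ? : ∀ i j → Dec (i ∈ₑ j)
  ∈ₑ? i j = (i ≟ src j) ⊎-dec (i ≟ tgt j)

  Adj : Fin n → Fin n → Set
  Adj u v = ∃ λ k → Joins k u v

  AdjL : Fin m → Fin m → Set
  AdjL i j = (i ≢ j) × (∃ λ v → (v ∈ₑ i) × (v ∈ₑ j))

data Walk {N : ℕ} (A : Fin N → Fin N → Set) : Fin N → Fin N → Set where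
  [] : ∀ u → Walk A u u
  _∷⟨_⟩_ : ∀ u {v w} → A u v → Walk A v w → Walk A u w

Connected : (Γ : SimpleGraph) → Set
Connected Γ = ∀ u v → Walk (SimpleGraph.Adj Γ) u v

module _ {c ℓ : Level} (𝔾 : Group c ℓ) where
  open Group 𝔾

  Central : Carrier → Set (c Level.⊔ ℓ)
  Central s = ∀ x → s ∙ x ≈ x ∙ s

  CentralWeakInvolution : Carrier → Set (c Level.⊔ ℓ)
  CentralWeakInvolution s = Central s × (s ∙ s ≈ ε)

  module _ {N : ℕ} (A : Fin N → Fin N → Set) where

    -- a gain function: ψ(v,u) = ψ(u,v)⁻¹ on adjacent pairs; values
    -- on non-adjacent pairs are irrelevant.
    IsGain : (Fin N → Fin N → Carrier) → Set ℓ
    IsGain ψ = ∀ u v → A u v → ψ v u ≈ (ψ u v) ⁻¹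

    GainEq : (ψ₁ ψ₂ : Fin N → Fin N → Carrier) → Set ℓ
    GainEq ψ₁ ψ₂ = ∀ u v → A u v → ψ₁ u v ≈ ψ₂ u v

    SwitchingEquivalent : (ψ₁ ψ₂ : Fin N → Fin N → Carrier) → Set (c Level.⊔ ℓ)
    SwitchingEquivalent ψ₁ ψ₂ =
      Σ (Fin N → Carrier) λ f → ∀ u v → A u v → ψ₂ u v ≈ (f u) ⁻¹ ∙ ψ₁ u v ∙ f v

    constGain : Carrier → Fin N → Fin N → Carrier
    constGain s _ _ = s

    walkGain : (Fin N → Fin N → Carrier) → ∀ {u v} → Walk A u v → Carrier
    walkGain ψ ([] u) = ε
    walkGain ψ (u ∷⟨ _ ⟩ ([] v)) = ψ u v
    walkGain ψ (u ∷⟨ a ⟩ (v ∷⟨ b ⟩ w)) = ψ u v ∙ walkGain ψ (v ∷⟨ b ⟩ w)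

    Balanced : (Fin N → Fin N → Carrier) → Set ℓ
    Balanced ψ = ∀ u (w : Walk A u u) → walkGain ψ w ≈ ε

  module _ (Γ : SimpleGraph) where
    open SimpleGraph Γ

    -- G-phases: only entries H i j with v_i ∈ e_j are meaningful (they
    -- lie in G); the remaining entries are the 0 of ℂG and are ignored.
    Phase : Set c
    Phase = Fin n → Fin m → Carrier

    Nphase : Phase
    Nphase _ _ = ε

    -- H₁ ∼_{l×r} H₂ :  H₁ = f* H₂ g, i.e. (H₁)_{ij} = f_i⁻¹ (H₂)_{ij} g_j
    _∼lr_ : Phase → Phase → Set (c Level.⊔ ℓ)
    H₁ ∼lr H₂ = Σ (Fin n → Carrier) λ f → Σ (Fin m → Carrier) λ g →
      ∀ i j → i ∈ₑ j → H₁ i j ≈ (f i) ⁻¹ ∙ H₂ i j ∙ g j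

    Ψ : Carrier → Phase → Fin n → Fin n → Carrier
    Ψ s H u v with any? (λ k → joins? k u v)
    ... | yes (k , _) = s ∙ H u k ∙ (H v k) ⁻¹
    ... | no _ = ε

    ΨL : Carrier → Phase → Fin m → Fin m → Carrier
    ΨL s H i j with any? (λ v → ∈ₑ? v i ×-dec ∈ₑ? v j)
    ... | yes (k , _) = s ∙ (H k i) ⁻¹ ∙ H k j
    ... | no _ = ε

    Compatible : Carrier → Carrier →
                 (Fin n → Fin n → Carrier) → (Fin m → Fin m → Carrier) → Set (c Level.⊔ ℓ)
    Compatible s₁ s₂ ψ ζ = Σ Phase λ H → GainEq Adj (Ψ s₁ H) ψ × GainEq AdjL (ΨL s₂ H) ζ

-- Conditions (2) and (3) both say that a gain function is s times a
-- coboundary u,v ↦ F u⁻¹ F v: for central s, switching the constant gain s by f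
-- gives s · f u⁻¹ f v. If H i j = f i⁻¹ g j, then the row labelling f is such a
-- potential for Ψ(H) and the column labelling g one for Ψ_L(H); conversely a
-- potential on either side, together with the entries of H, determines the
-- missing labelling. On a connected graph a gain function is balanced exactly
-- when it is a coboundary (take F u to be the gain of a walk from a base
-- vertex), so for s₁ = s₂ = 1 the equivalence (2) ⇔ (3) becomes the balance
-- statement, L(Γ) being connected along with Γ.
module Submission where

open import Defs
open import Level using (Level; _⊔_)
open import Data.Nat using (ℕ; _<_)
open import Data.Fin using (Fin; _≟_; fromℕ<)
open import Data.Fin.Properties using (any?)
open import Data.Product using (Σ; ∃; _×_; _,_; proj₁; proj₂)
open import Data.Sum using (inj₁; inj₂)
open import Data.Empty using (⊥-elim)
open import Relation.Nullary using (Dec; yes; no)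
open import Relation.Nullary.Decidable using (_×-dec_)
open import Relation.Binary.PropositionalEquality as ≡ using (_≡_; _≢_)
open import Function.Base using (_∘_)
open import Function.Bundles using (_⇔_; mk⇔)
open import Function.Construct.Symmetry using (⇔-sym)
open import Function.Properties.Equivalence using () renaming (trans to ⇔-trans)
open import Function.Related.Propositional using (module EquationalReasoning)
open import Algebra.Bundles using (Group)
import Algebra.Properties.Group as GroupProperties
import Relation.Binary.Reasoning.Setoid as SetoidReasoning

module _ {N : ℕ} {A : Fin N → Fin N → Set} where

  infixr 5 _++_

  _++_ : ∀ {u v x} → Walk A u v → Walk A v x → Walk A u x
  [] _ ++ q = q
  (u ∷⟨ a ⟩ p) ++ q = u ∷⟨ a ⟩ (p ++ q)

  reverse : (∀ {u v} → A u v → A v u) → ∀ {u v} → Walk A u v → Walk A v u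
  reverse sym ([] u) = [] u
  reverse sym (_∷⟨_⟩_ u {v} a w) = reverse sym w ++ (v ∷⟨ sym a ⟩ [] u)

module GroupLemmas {c ℓ} (𝔾 : Group c ℓ) where
  open Group 𝔾
  open GroupProperties 𝔾
  open SetoidReasoning setoid

  [x⁻¹∙z]∙[y⁻¹∙z]⁻¹≈x⁻¹∙y : ∀ x y z → (x ⁻¹ ∙ z) ∙ (y ⁻¹ ∙ z) ⁻¹ ≈ x ⁻¹ ∙ y
  [x⁻¹∙z]∙[y⁻¹∙z]⁻¹≈x⁻¹∙y x y z = begin
    (x ⁻¹ ∙ z) ∙ (y ⁻¹ ∙ z) ⁻¹     ≈⟨ ∙-congˡ (⁻¹-anti-homo-∙ (y ⁻¹) z) ⟩
    (x ⁻¹ ∙ z) ∙ (z ⁻¹ ∙ y ⁻¹ ⁻¹)  ≈⟨ ∙-congˡ (∙-congˡ (⁻¹-involutive y)) ⟩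
    (x ⁻¹ ∙ z) ∙ (z ⁻¹ ∙ y)        ≈⟨ assoc (x ⁻¹) z (z ⁻¹ ∙ y) ⟩
    x ⁻¹ ∙ (z ∙ (z ⁻¹ ∙ y))        ≈⟨ ∙-congˡ (\\-leftDividesˡ z y) ⟩
    x ⁻¹ ∙ y                        ∎

  [z⁻¹∙x]⁻¹∙[z⁻¹∙y]≈x⁻¹∙y : ∀ x y z → (z ⁻¹ ∙ x) ⁻¹ ∙ (z ⁻¹ ∙ y) ≈ x ⁻¹ ∙ y
  [z⁻¹∙x]⁻¹∙[z⁻¹∙y]≈x⁻¹∙y x y z = begin
    (z ⁻¹ ∙ x) ⁻¹ ∙ (z ⁻¹ ∙ y)     ≈⟨ ∙-congʳ (⁻¹-anti-homo-∙ (z ⁻¹) x) ⟩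
    (x ⁻¹ ∙ z ⁻¹ ⁻¹) ∙ (z ⁻¹ ∙ y)  ≈⟨ ∙-congʳ (∙-congˡ (⁻¹-involutive z)) ⟩
    (x ⁻¹ ∙ z) ∙ (z ⁻¹ ∙ y)        ≈⟨ assoc (x ⁻¹) z (z ⁻¹ ∙ y) ⟩
    x ⁻¹ ∙ (z ∙ (z ⁻¹ ∙ y))        ≈⟨ ∙-congˡ (\\-leftDividesˡ z y) ⟩
    x ⁻¹ ∙ y                        ∎

  x∙y⁻¹≈a⁻¹∙b⇒y≈b⁻¹∙[a∙x] : ∀ {x y a b} → x ∙ y ⁻¹ ≈ a ⁻¹ ∙ b → y ≈ b ⁻¹ ∙ (a ∙ x)
  x∙y⁻¹≈a⁻¹∙b⇒y≈b⁻¹∙[a∙x] {x} {y} {a} {b} eq = y≈x\\z b y (a ∙ x) (begin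
    b ∙ y                 ≈⟨ ∙-congʳ (\\-leftDividesˡ a b) ⟨
    a ∙ (a ⁻¹ ∙ b) ∙ y    ≈⟨ ∙-congʳ (∙-congˡ eq) ⟨
    a ∙ (x ∙ y ⁻¹) ∙ y    ≈⟨ assoc a (x ∙ y ⁻¹) y ⟩
    a ∙ (x ∙ y ⁻¹ ∙ y)    ≈⟨ ∙-congˡ (//-rightDividesˡ y x) ⟩
    a ∙ x                 ∎)

  x⁻¹∙y≈a⁻¹∙b⇒x∙a⁻¹≈y∙b⁻¹ : ∀ {x y a b} → x ⁻¹ ∙ y ≈ a ⁻¹ ∙ b → x ∙ a ⁻¹ ≈ y ∙ b ⁻¹
  x⁻¹∙y≈a⁻¹∙b⇒x∙a⁻¹≈y∙b⁻¹ {x} {y} {a} {b} eq = begin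
    x ∙ a ⁻¹                ≈⟨ //-rightDividesʳ b (x ∙ a ⁻¹) ⟨
    x ∙ a ⁻¹ ∙ b ∙ b ⁻¹     ≈⟨ ∙-congʳ (assoc x (a ⁻¹) b) ⟩
    x ∙ (a ⁻¹ ∙ b) ∙ b ⁻¹   ≈⟨ ∙-congʳ (∙-congˡ eq) ⟨
    x ∙ (x ⁻¹ ∙ y) ∙ b ⁻¹   ≈⟨ ∙-congʳ (\\-leftDividesˡ x y) ⟩
    y ∙ b ⁻¹                ∎

  x∙[y∙z⁻¹]≈ε⇒y≈x⁻¹∙z : ∀ {x y z} → x ∙ (y ∙ z ⁻¹) ≈ ε → y ≈ x ⁻¹ ∙ z
  x∙[y∙z⁻¹]≈ε⇒y≈x⁻¹∙z {x} {y} {z} eq = begin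
    y               ≈⟨ //-rightDividesˡ z y ⟨
    y ∙ z ⁻¹ ∙ z    ≈⟨ ∙-congʳ (inverseʳ-unique x (y ∙ z ⁻¹) eq) ⟩
    x ⁻¹ ∙ z        ∎

  y≈a⁻¹∙x∙b⇒x≈a⁻¹⁻¹∙y∙b⁻¹ : ∀ {x y a b} → y ≈ a ⁻¹ ∙ x ∙ b → x ≈ a ⁻¹ ⁻¹ ∙ y ∙ b ⁻¹
  y≈a⁻¹∙x∙b⇒x≈a⁻¹⁻¹∙y∙b⁻¹ {x} {y} {a} {b} eq = sym (begin
    a ⁻¹ ⁻¹ ∙ y ∙ b ⁻¹              ≈⟨ ∙-congʳ (∙-cong (⁻¹-involutive a) eq) ⟩
    a ∙ (a ⁻¹ ∙ x ∙ b) ∙ b ⁻¹       ≈⟨ ∙-congʳ (∙-congˡ (assoc (a ⁻¹) x b)) ⟩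
    a ∙ (a ⁻¹ ∙ (x ∙ b)) ∙ b ⁻¹     ≈⟨ ∙-congʳ (\\-leftDividesˡ a (x ∙ b)) ⟩
    x ∙ b ∙ b ⁻¹                    ≈⟨ //-rightDividesʳ b x ⟩
    x                               ∎)

  central⇒x∙s∙y≈s∙[x∙y] : ∀ {s} → Central 𝔾 s → ∀ x y → x ∙ s ∙ y ≈ s ∙ (x ∙ y)
  central⇒x∙s∙y≈s∙[x∙y] {s} s-central x y = trans (∙-congʳ (sym (s-central x))) (assoc s x y)

module GainGraphs {c ℓ} (𝔾 : Group c ℓ) {N : ℕ} (A : Fin N → Fin N → Set) where
  open Group 𝔾
  open GroupProperties 𝔾
  open GroupLemmas 𝔾
  open SetoidReasoning setoid

  Potential : Carrier → (Fin N → Fin N → Carrier) → Set (c ⊔ ℓ)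
  Potential s φ = Σ (Fin N → Carrier) λ F → ∀ u v → A u v → φ u v ≈ s ∙ (F u ⁻¹ ∙ F v)

  Potential-resp : ∀ {s t φ φ′} → s ≈ t → GainEq 𝔾 A φ φ′ → Potential s φ ⇔ Potential t φ′
  Potential-resp s≈t φ≈φ′ =
    mk⇔ (resp s≈t φ≈φ′) (resp (sym s≈t) λ u v a → sym (φ≈φ′ u v a))
    where
    resp : ∀ {s t φ φ′} → s ≈ t → GainEq 𝔾 A φ φ′ → Potential s φ → Potential t φ′
    resp s≈t φ≈φ′ (F , φ≈) = F , λ u v a → trans (sym (φ≈φ′ u v a)) (trans (φ≈ u v a) (∙-congʳ s≈t))

  switchingEquivalent-sym : ∀ {φ ψ} → SwitchingEquivalent 𝔾 A φ ψ → SwitchingEquivalent 𝔾 A ψ φ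
  switchingEquivalent-sym (f , ψ≈) = (λ u → f u ⁻¹) , λ u v a → y≈a⁻¹∙x∙b⇒x≈a⁻¹⁻¹∙y∙b⁻¹ (ψ≈ u v a)

  switchingEquivalent-const⇔Potential : ∀ {s φ} → Central 𝔾 s →
    SwitchingEquivalent 𝔾 A φ (constGain 𝔾 A s) ⇔ Potential s φ
  switchingEquivalent-const⇔Potential {s} {φ} s-central =
    mk⇔ (fromConst ∘ switchingEquivalent-sym) (switchingEquivalent-sym ∘ toConst)
    where
    fromConst : SwitchingEquivalent 𝔾 A (constGain 𝔾 A s) φ → Potential s φ
    fromConst (f , φ≈) = f , λ u v a → trans (φ≈ u v a) (central⇒x∙s∙y≈s∙[x∙y] s-central _ _)
    toConst : Potential s φ → SwitchingEquivalent 𝔾 A (constGain 𝔾 A s) φ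
    toConst (F , φ≈) = F , λ u v a → trans (φ≈ u v a) (sym (central⇒x∙s∙y≈s∙[x∙y] s-central _ _))

  module _ (φ : Fin N → Fin N → Carrier) where

    walkGain-∷ : ∀ {u v x} (a : A u v) (w : Walk A v x) →
                 walkGain 𝔾 A φ (u ∷⟨ a ⟩ w) ≈ φ u v ∙ walkGain 𝔾 A φ w
    walkGain-∷ a ([] _) = sym (identityʳ _)
    walkGain-∷ a (_ ∷⟨ _ ⟩ _) = refl

    walkGain-++ : ∀ {u v x} (p : Walk A u v) (q : Walk A v x) →
                  walkGain 𝔾 A φ (p ++ q) ≈ walkGain 𝔾 A φ p ∙ walkGain 𝔾 A φ q
    walkGain-++ ([] _) q = sym (identityˡ _)
    walkGain-++ (_∷⟨_⟩_ u {v} a p) q = begin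
      walkGain 𝔾 A φ (u ∷⟨ a ⟩ (p ++ q))                   ≈⟨ walkGain-∷ a (p ++ q) ⟩
      φ u v ∙ walkGain 𝔾 A φ (p ++ q)                      ≈⟨ ∙-congˡ (walkGain-++ p q) ⟩
      φ u v ∙ (walkGain 𝔾 A φ p ∙ walkGain 𝔾 A φ q)        ≈⟨ assoc _ _ _ ⟨
      φ u v ∙ walkGain 𝔾 A φ p ∙ walkGain 𝔾 A φ q          ≈⟨ ∙-congʳ (walkGain-∷ a p) ⟨
      walkGain 𝔾 A φ (u ∷⟨ a ⟩ p) ∙ walkGain 𝔾 A φ q       ∎

    walkGain-reverse : (A-sym : ∀ {u v} → A u v → A v u) → IsGain 𝔾 A φ →
                       ∀ {u v} (w : Walk A u v) →
                       walkGain 𝔾 A φ (reverse A-sym w) ≈ walkGain 𝔾 A φ w ⁻¹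
    walkGain-reverse A-sym gain ([] _) = sym ε⁻¹≈ε
    walkGain-reverse A-sym gain (_∷⟨_⟩_ u {v} a w) = begin
      walkGain 𝔾 A φ (reverse A-sym w ++ (v ∷⟨ A-sym a ⟩ [] u))   ≈⟨ walkGain-++ (reverse A-sym w) _ ⟩
      walkGain 𝔾 A φ (reverse A-sym w) ∙ φ v u                    ≈⟨ ∙-cong (walkGain-reverse A-sym gain w) (gain u v a) ⟩
      walkGain 𝔾 A φ w ⁻¹ ∙ φ u v ⁻¹                             ≈⟨ ⁻¹-anti-homo-∙ _ _ ⟨
      (φ u v ∙ walkGain 𝔾 A φ w) ⁻¹                               ≈⟨ ⁻¹-cong (walkGain-∷ a w) ⟨
      walkGain 𝔾 A φ (u ∷⟨ a ⟩ w) ⁻¹                              ∎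

    walkGain-telescopes : (F : Fin N → Carrier) → (∀ u v → A u v → φ u v ≈ ε ∙ (F u ⁻¹ ∙ F v)) →
                          ∀ {u x} (w : Walk A u x) → F u ∙ walkGain 𝔾 A φ w ≈ F x
    walkGain-telescopes F φ≈ ([] _) = identityʳ _
    walkGain-telescopes F φ≈ (_∷⟨_⟩_ u {v} {x} a w) = begin
      F u ∙ walkGain 𝔾 A φ (u ∷⟨ a ⟩ w)     ≈⟨ ∙-congˡ (walkGain-∷ a w) ⟩
      F u ∙ (φ u v ∙ walkGain 𝔾 A φ w)      ≈⟨ assoc _ _ _ ⟨
      F u ∙ φ u v ∙ walkGain 𝔾 A φ w        ≈⟨ ∙-congʳ (∙-congˡ (trans (φ≈ u v a) (identityˡ _))) ⟩
      F u ∙ (F u ⁻¹ ∙ F v) ∙ walkGain 𝔾 A φ w ≈⟨ ∙-congʳ (\\-leftDividesˡ (F u) (F v)) ⟩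
      F v ∙ walkGain 𝔾 A φ w                ≈⟨ walkGain-telescopes F φ≈ w ⟩
      F x                                   ∎

    Potential-ε⇒balanced : Potential ε φ → Balanced 𝔾 A φ
    Potential-ε⇒balanced (F , φ≈) u w =
      ∙-cancelˡ (F u) _ _ (trans (walkGain-telescopes F φ≈ w) (sym (identityʳ (F u))))

    -- Balance of the closed walk b ⇝ u → v ⇝ b is the potential equation at u v.
    balanced⇒Potential-ε : (A-sym : ∀ {u v} → A u v → A v u) → IsGain 𝔾 A φ →
                           (∀ u v → Walk A u v) → Fin N → Balanced 𝔾 A φ → Potential ε φ
    balanced⇒Potential-ε A-sym gain walk b balanced = W , λ u v a →
      trans (x∙[y∙z⁻¹]≈ε⇒y≈x⁻¹∙z (closed u v a)) (sym (identityˡ _))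
      where
      W : Fin N → Carrier
      W x = walkGain 𝔾 A φ (walk b x)
      closed : ∀ u v → A u v → W u ∙ (φ u v ∙ W v ⁻¹) ≈ ε
      closed u v a = begin
        W u ∙ (φ u v ∙ W v ⁻¹)                                         ≈⟨ ∙-congˡ (∙-congˡ (walkGain-reverse A-sym gain (walk b v))) ⟨
        W u ∙ (φ u v ∙ walkGain 𝔾 A φ (reverse A-sym (walk b v)))       ≈⟨ ∙-congˡ (walkGain-∷ a (reverse A-sym (walk b v))) ⟨
        W u ∙ walkGain 𝔾 A φ (u ∷⟨ a ⟩ reverse A-sym (walk b v))        ≈⟨ walkGain-++ (walk b u) (u ∷⟨ a ⟩ reverse A-sym (walk b v)) ⟨
        walkGain 𝔾 A φ (walk b u ++ u ∷⟨ a ⟩ reverse A-sym (walk b v))  ≈⟨ balanced b (walk b u ++ u ∷⟨ a ⟩ reverse A-sym (walk b v)) ⟩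
        ε                                                              ∎

    balanced⇔Potential-ε : (A-sym : ∀ {u v} → A u v → A v u) → IsGain 𝔾 A φ →
                           (∀ u v → Walk A u v) → Fin N → Balanced 𝔾 A φ ⇔ Potential ε φ
    balanced⇔Potential-ε A-sym gain walk b =
      mk⇔ (balanced⇒Potential-ε A-sym gain walk b) Potential-ε⇒balanced

module Phases {c ℓ} (𝔾 : Group c ℓ) (Γ : SimpleGraph) where
  open Group 𝔾
  open GroupProperties 𝔾
  open GroupLemmas 𝔾
  open SimpleGraph Γ
  open SetoidReasoning setoid
  module V = GainGraphs 𝔾 Adj
  module E = GainGraphs 𝔾 AdjL

  Adj-sym : ∀ {u v} → Adj u v → Adj v u
  Adj-sym (k , inj₁ uv) = k , inj₂ uv
  Adj-sym (k , inj₂ vu) = k , inj₁ vu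

  AdjL-sym : ∀ {i j} → AdjL i j → AdjL j i
  AdjL-sym (i≢j , v , vi , vj) = (i≢j ∘ ≡.sym) , v , vj , vi

  joins⇒∈ₑ : ∀ {k u v} → Joins k u v → u ∈ₑ k × v ∈ₑ k
  joins⇒∈ₑ (inj₁ (≡.refl , ≡.refl)) = inj₁ ≡.refl , inj₂ ≡.refl
  joins⇒∈ₑ (inj₂ (≡.refl , ≡.refl)) = inj₂ ≡.refl , inj₁ ≡.refl

  joins-unique : ∀ {k k′ u v} → Joins k u v → Joins k′ u v → k ≡ k′
  joins-unique {k} {k′} J J′ = noMulti k k′ (joins-endpoints J J′)
    where
    joins-endpoints : ∀ {u v} → Joins k u v → Joins k′ u v → Joins k (src k′) (tgt k′)
    joins-endpoints (inj₁ (p , q)) (inj₁ (p′ , q′)) = inj₁ (≡.trans p (≡.sym p′) , ≡.trans q (≡.sym q′))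
    joins-endpoints (inj₁ (p , q)) (inj₂ (p′ , q′)) = inj₂ (≡.trans p (≡.sym q′) , ≡.trans q (≡.sym p′))
    joins-endpoints (inj₂ (p , q)) (inj₁ (p′ , q′)) = inj₂ (≡.trans p (≡.sym q′) , ≡.trans q (≡.sym p′))
    joins-endpoints (inj₂ (p , q)) (inj₂ (p′ , q′)) = inj₁ (≡.trans p (≡.sym p′) , ≡.trans q (≡.sym q′))

  two-common-endpoints⇒≡ : ∀ {i j v w} → v ≢ w → v ∈ₑ i → w ∈ₑ i → v ∈ₑ j → w ∈ₑ j → i ≡ j
  two-common-endpoints⇒≡ {i} {j} {v} {w} v≢w vi wi vj wj = noMulti i j (joins vi wi vj wj)
    where
    joins : v ∈ₑ i → w ∈ₑ i → v ∈ₑ j → w ∈ₑ j → Joins i (src j) (tgt j)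
    joins (inj₁ p) (inj₁ q) _ _ = ⊥-elim (v≢w (≡.trans p (≡.sym q)))
    joins (inj₂ p) (inj₂ q) _ _ = ⊥-elim (v≢w (≡.trans p (≡.sym q)))
    joins _ _ (inj₁ p) (inj₁ q) = ⊥-elim (v≢w (≡.trans p (≡.sym q)))
    joins _ _ (inj₂ p) (inj₂ q) = ⊥-elim (v≢w (≡.trans p (≡.sym q)))
    joins (inj₁ p) (inj₂ q) (inj₁ p′) (inj₂ q′) = inj₁ (≡.trans (≡.sym p) p′ , ≡.trans (≡.sym q) q′)
    joins (inj₁ p) (inj₂ q) (inj₂ p′) (inj₁ q′) = inj₂ (≡.trans (≡.sym p) p′ , ≡.trans (≡.sym q) q′)
    joins (inj₂ p) (inj₁ q) (inj₁ p′) (inj₂ q′) = inj₂ (≡.trans (≡.sym q) q′ , ≡.trans (≡.sym p) p′)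
    joins (inj₂ p) (inj₁ q) (inj₂ p′) (inj₁ q′) = inj₁ (≡.trans (≡.sym q) q′ , ≡.trans (≡.sym p) p′)

  Ψ-joins : ∀ s H {u v k} → Joins k u v → Ψ 𝔾 Γ s H u v ≈ s ∙ (H u k ∙ H v k ⁻¹)
  Ψ-joins s H {u} {v} {k} J with any? (λ k → joins? k u v)
  ... | yes (k′ , J′) rewrite joins-unique J′ J = assoc s (H u k) (H v k ⁻¹)
  ... | no ¬J = ⊥-elim (¬J (k , J))

  ΨL-meets : ∀ s H {i j v} → i ≢ j → v ∈ₑ i → v ∈ₑ j → ΨL 𝔾 Γ s H i j ≈ s ∙ (H v i ⁻¹ ∙ H v j)
  ΨL-meets s H {i} {j} {v} i≢j vi vj with any? (λ w → ∈ₑ? w i ×-dec ∈ₑ? w j)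
  ... | no ¬w = ⊥-elim (¬w (v , vi , vj))
  ... | yes (w , wi , wj) with w ≟ v
  ...   | yes ≡.refl = assoc s (H w i ⁻¹) (H w j)
  ...   | no w≢v = ⊥-elim (i≢j (two-common-endpoints⇒≡ w≢v wi vi wj vj))

  _∼N : Phase 𝔾 Γ → Set (c ⊔ ℓ)
  H ∼N = _∼lr_ 𝔾 Γ H (Nphase 𝔾 Γ)

  ∼N⇒Potential : ∀ s H → H ∼N → V.Potential s (Ψ 𝔾 Γ s H)
  ∼N⇒Potential s H (f , g , H≈) = f , λ { u v (k , J) → begin
    Ψ 𝔾 Γ s H u v                            ≈⟨ Ψ-joins s H J ⟩
    s ∙ (H u k ∙ H v k ⁻¹)                   ≈⟨ ∙-congˡ (∙-cong (entry (proj₁ (joins⇒∈ₑ J))) (⁻¹-cong (entry (proj₂ (joins⇒∈ₑ J))))) ⟩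
    s ∙ ((f u ⁻¹ ∙ g k) ∙ (f v ⁻¹ ∙ g k) ⁻¹)  ≈⟨ ∙-congˡ ([x⁻¹∙z]∙[y⁻¹∙z]⁻¹≈x⁻¹∙y (f u) (f v) (g k)) ⟩
    s ∙ (f u ⁻¹ ∙ f v)                       ∎ }
    where
    entry : ∀ {i j} → i ∈ₑ j → H i j ≈ f i ⁻¹ ∙ g j
    entry {i} {j} ij = trans (H≈ i j ij) (∙-congʳ (identityʳ (f i ⁻¹)))

  ∼N⇒PotentialL : ∀ s H → H ∼N → E.Potential s (ΨL 𝔾 Γ s H)
  ∼N⇒PotentialL s H (f , g , H≈) = g , λ { i j (i≢j , v , vi , vj) → begin
    ΨL 𝔾 Γ s H i j                           ≈⟨ ΨL-meets s H i≢j vi vj ⟩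
    s ∙ (H v i ⁻¹ ∙ H v j)                   ≈⟨ ∙-congˡ (∙-cong (⁻¹-cong (entry vi)) (entry vj)) ⟩
    s ∙ ((f v ⁻¹ ∙ g i) ⁻¹ ∙ (f v ⁻¹ ∙ g j))  ≈⟨ ∙-congˡ ([z⁻¹∙x]⁻¹∙[z⁻¹∙y]≈x⁻¹∙y (g i) (g j) (f v)) ⟩
    s ∙ (g i ⁻¹ ∙ g j)                       ∎ }
    where
    entry : ∀ {i j} → i ∈ₑ j → H i j ≈ f i ⁻¹ ∙ g j
    entry {i} {j} ij = trans (H≈ i j ij) (∙-congʳ (identityʳ (f i ⁻¹)))

  -- The column label of e_j is forced by the entry at src j; the potential
  -- equation along e_j then gives the entry at tgt j.
  Potential⇒∼N : ∀ s H → V.Potential s (Ψ 𝔾 Γ s H) → H ∼N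
  Potential⇒∼N s H (F , Ψ≈) = F , (λ j → F (src j) ∙ H (src j) j) , entry
    where
    along : ∀ j → H (src j) j ∙ H (tgt j) j ⁻¹ ≈ F (src j) ⁻¹ ∙ F (tgt j)
    along j = ∙-cancelˡ s _ _ (trans (sym (Ψ-joins s H J)) (Ψ≈ (src j) (tgt j) (j , J)))
      where J = inj₁ (≡.refl , ≡.refl)
    entry : ∀ i j → i ∈ₑ j → H i j ≈ F i ⁻¹ ∙ ε ∙ (F (src j) ∙ H (src j) j)
    entry i j i∈j = trans (entry′ i∈j) (sym (∙-congʳ (identityʳ (F i ⁻¹))))
      where
      entry′ : i ∈ₑ j → H i j ≈ F i ⁻¹ ∙ (F (src j) ∙ H (src j) j)
      entry′ (inj₁ ≡.refl) = sym (\\-leftDividesʳ (F i) (H i j))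
      entry′ (inj₂ ≡.refl) = x∙y⁻¹≈a⁻¹∙b⇒y≈b⁻¹∙[a∙x] (along j)

  -- Along the edges through a vertex v the products H v e ∙ F e ⁻¹ agree, and
  -- their common value is the (inverse) row label of v.
  PotentialL⇒∼N : ∀ s H → E.Potential s (ΨL 𝔾 Γ s H) → H ∼N
  PotentialL⇒∼N s H (F , ΨL≈) = (λ v → label v (any? (λ e → ∈ₑ? v e))) , F ,
                                  λ v j v∈j → entry v j v∈j (any? (λ e → ∈ₑ? v e))
    where
    row-constant : ∀ {v i j} → v ∈ₑ i → v ∈ₑ j → H v i ∙ F i ⁻¹ ≈ H v j ∙ F j ⁻¹
    row-constant {v} {i} {j} vi vj with i ≟ j
    ... | yes ≡.refl = refl
    ... | no i≢j = x⁻¹∙y≈a⁻¹∙b⇒x∙a⁻¹≈y∙b⁻¹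
                     (∙-cancelˡ s _ _ (trans (sym (ΨL-meets s H i≢j vi vj)) (ΨL≈ i j (i≢j , v , vi , vj))))
    -- a vertex on no edge constrains nothing, so ε is an arbitrary label for it
    label : ∀ v → Dec (∃ λ e → v ∈ₑ e) → Carrier
    label v (yes (e , _)) = (H v e ∙ F e ⁻¹) ⁻¹
    label v (no _) = ε
    entry : ∀ v j → v ∈ₑ j → (d : Dec (∃ λ e → v ∈ₑ e)) → H v j ≈ label v d ⁻¹ ∙ ε ∙ F j
    entry v j v∈j (no v∉) = ⊥-elim (v∉ (j , v∈j))
    entry v j v∈j (yes (e , v∈e)) = sym (begin
      (H v e ∙ F e ⁻¹) ⁻¹ ⁻¹ ∙ ε ∙ F j   ≈⟨ ∙-congʳ (trans (identityʳ _) (⁻¹-involutive _)) ⟩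
      H v e ∙ F e ⁻¹ ∙ F j               ≈⟨ ∙-congʳ (row-constant v∈e v∈j) ⟩
      H v j ∙ F j ⁻¹ ∙ F j               ≈⟨ //-rightDividesˡ (F j) (H v j) ⟩
      H v j                              ∎)

  ∼N⇔Potential : ∀ s H → H ∼N ⇔ V.Potential s (Ψ 𝔾 Γ s H)
  ∼N⇔Potential s H = mk⇔ (∼N⇒Potential s H) (Potential⇒∼N s H)

  ∼N⇔PotentialL : ∀ s H → H ∼N ⇔ E.Potential s (ΨL 𝔾 Γ s H)
  ∼N⇔PotentialL s H = mk⇔ (∼N⇒PotentialL s H) (PotentialL⇒∼N s H)

  ∼N⇔switchingEquivalent : ∀ {s} → Central 𝔾 s → ∀ H →
    H ∼N ⇔ SwitchingEquivalent 𝔾 Adj (Ψ 𝔾 Γ s H) (constGain 𝔾 Adj s)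
  ∼N⇔switchingEquivalent {s} s-central H =
    ⇔-trans (∼N⇔Potential s H) (⇔-sym (V.switchingEquivalent-const⇔Potential s-central))

  ∼N⇔switchingEquivalentL : ∀ {s} → Central 𝔾 s → ∀ H →
    H ∼N ⇔ SwitchingEquivalent 𝔾 AdjL (ΨL 𝔾 Γ s H) (constGain 𝔾 AdjL s)
  ∼N⇔switchingEquivalentL {s} s-central H =
    ⇔-trans (∼N⇔PotentialL s H) (⇔-sym (E.switchingEquivalent-const⇔Potential s-central))

  walk-through-common-endpoint : ∀ {i j v} → v ∈ₑ i → v ∈ₑ j → Walk AdjL i j
  walk-through-common-endpoint {i} {j} vi vj with i ≟ j
  ... | yes ≡.refl = [] i
  ... | no i≢j = i ∷⟨ i≢j , _ , vi , vj ⟩ [] j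

  lift-walk : ∀ {u w i j} → Walk Adj u w → u ∈ₑ i → w ∈ₑ j → Walk AdjL i j
  lift-walk ([] _) ui uj = walk-through-common-endpoint ui uj
  lift-walk (_ ∷⟨ k , J ⟩ w) ui wj =
    walk-through-common-endpoint ui (proj₁ (joins⇒∈ₑ J)) ++ lift-walk w (proj₂ (joins⇒∈ₑ J)) wj

  lineGraph-connected : Connected Γ → ∀ i j → Walk AdjL i j
  lineGraph-connected conn i j = lift-walk (conn (src i) (src j)) (inj₁ ≡.refl) (inj₁ ≡.refl)

module _ {c ℓ} (𝔾 : Group c ℓ) (Γ : SimpleGraph) where
  open Group 𝔾 using (_≈_; ε)
  open SimpleGraph Γ
  open Phases 𝔾 Γ
  open EquationalReasoning

  compatible⇒balanced⇔balanced : Connected Γ → Fin m → ∀ {s₁ s₂ ψ ζ} → s₁ ≈ ε → s₂ ≈ ε →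
    IsGain 𝔾 Adj ψ → IsGain 𝔾 AdjL ζ → Compatible 𝔾 Γ s₁ s₂ ψ ζ →
    Balanced 𝔾 Adj ψ ⇔ Balanced 𝔾 AdjL ζ
  compatible⇒balanced⇔balanced conn e {s₁} {s₂} {ψ} {ζ} s₁≈ε s₂≈ε ψ-gain ζ-gain (H , Ψ≈ψ , ΨL≈ζ) = begin
    Balanced 𝔾 Adj ψ              ∼⟨ V.balanced⇔Potential-ε ψ Adj-sym ψ-gain conn (src e) ⟩
    V.Potential ε ψ               ∼⟨ ⇔-sym (V.Potential-resp s₁≈ε Ψ≈ψ) ⟩
    V.Potential s₁ (Ψ 𝔾 Γ s₁ H)   ∼⟨ ⇔-sym (∼N⇔Potential s₁ H) ⟩
    H ∼N                          ∼⟨ ∼N⇔PotentialL s₂ H ⟩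
    E.Potential s₂ (ΨL 𝔾 Γ s₂ H)  ∼⟨ E.Potential-resp s₂≈ε ΨL≈ζ ⟩
    E.Potential ε ζ               ∼⟨ ⇔-sym (E.balanced⇔Potential-ε ζ AdjL-sym ζ-gain (lineGraph-connected conn) e) ⟩
    Balanced 𝔾 AdjL ζ             ∎

corollary4p27 : {c ℓ : Level} (𝔾 : Group c ℓ) (Γ : SimpleGraph) →
    Connected Γ → 0 < SimpleGraph.m Γ →
    (s₁ s₂ : Group.Carrier 𝔾) →
    CentralWeakInvolution 𝔾 s₁ → CentralWeakInvolution 𝔾 s₂ →
    ((H : Phase 𝔾 Γ) →
       (_∼lr_ 𝔾 Γ H (Nphase 𝔾 Γ)
          ⇔ SwitchingEquivalent 𝔾 (SimpleGraph.Adj Γ) (Ψ 𝔾 Γ s₁ H) (constGain 𝔾 (SimpleGraph.Adj Γ) s₁))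
       × (SwitchingEquivalent 𝔾 (SimpleGraph.Adj Γ) (Ψ 𝔾 Γ s₁ H) (constGain 𝔾 (SimpleGraph.Adj Γ) s₁)
          ⇔ SwitchingEquivalent 𝔾 (SimpleGraph.AdjL Γ) (ΨL 𝔾 Γ s₂ H) (constGain 𝔾 (SimpleGraph.AdjL Γ) s₂)))
    × (Group._≈_ 𝔾 s₁ (Group.ε 𝔾) → Group._≈_ 𝔾 s₂ (Group.ε 𝔾) →
       (ψ : _) (ζ : _) →
       IsGain 𝔾 (SimpleGraph.Adj Γ) ψ → IsGain 𝔾 (SimpleGraph.AdjL Γ) ζ →
       Compatible 𝔾 Γ s₁ s₂ ψ ζ →
       (Balanced 𝔾 (SimpleGraph.Adj Γ) ψ ⇔ Balanced 𝔾 (SimpleGraph.AdjL Γ) ζ))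
corollary4p27 𝔾 Γ conn 0<m s₁ s₂ (s₁-central , _) (s₂-central , _) =
  (λ H → ∼N⇔switchingEquivalent s₁-central H
       , ⇔-trans (⇔-sym (∼N⇔switchingEquivalent s₁-central H)) (∼N⇔switchingEquivalentL s₂-central H)) ,
  λ s₁≈ε s₂≈ε ψ ζ → compatible⇒balanced⇔balanced 𝔾 Γ conn (fromℕ< 0<m) s₁≈ε s₂≈ε
  where open Phases 𝔾 Γ
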